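{- $\mathbb{P}(\mathbb{P}(K_3))=\mathbb{P}(K_3)$; that is, for every $\Gamma\subseteq For$, the consequence set of $\Gamma$ in the paraconsistentization of $\mathbb{P}(K_3)$ equals $Cn^{\mathbb{P}}_{K_3}(\Gamma)$.
   Context: $For$ is the set of formulas built from a countable set $Prop$ of propositional letters with $\neg,\vee,\wedge,\rightarrow$. $K_3$ (Kleene) is given by the matrix with truth values $\{0,1/2,1\}$, designated set $\{1\}$, $f_\neg(x)=1-x$, $f_\vee=\max$, $f_\wedge=\min$, $f_\rightarrow(x,y)=\max\{1-x,y\}$; valuations are maps $Prop\to\{0,1/2,1\}$ extended via these functions. $\Gamma\vDash_{K_3}\alpha$ iff every valuation giving all members of $\Gamma$ value $1$ gives $\alpha$ value $1$; $Cn_{K_3}(\Gamma)=\{\alpha:\Gamma\vDash_{K_3}\alpha\}$. For a consequence structure $L=\langle X,Cn_L\rangle$ ($X$ nonempty, $Cn_L:\wp(X)\to\wp(X)$ any map), $\Gamma\subseteq X$ is $L$-consistent iff $Cn_L(\Gamma)\neq X$, and $\mathbb{P}(L)=\langle X,Cn^{\mathbb{P}}_L\rangle$ with $Cn^{\mathbb{P}}_L(\Gamma)=\bigcup\{Cn_L(\Gamma'):\Gamma'\subseteq\Gamma,\ \Gamma'\ L\text{ -consistent}\}$. $\mathbb{P}(K_3)$ is the paraconsistentization of $\langle For,Cn_{K_3}\rangle$ and $\mathbb{P}(\mathbb{P}(K_3))$ that of $\mathbb{P}(K_3)$. -}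

module Defs where

open import Level using (Level; _⊔_; suc; 0ℓ)
open import Data.Nat using (ℕ)
open import Data.Product using (Σ; _×_)
open import Relation.Nullary using (¬_)
open import Relation.Binary.PropositionalEquality using (_≡_)
open import Relation.Unary using (Pred; _⊆_; _∈_)

Prop : Set
Prop = ℕ

data For : Set where
  var  : Prop → For
  ¬'_  : For → For
  _∨'_ : For → For → For
  _∧'_ : For → For → For
  _⇒'_ : For → For → For

data V3 : Set where
  v0 v½ v1 : V3

f¬ : V3 → V3
f¬ v0 = v1
f¬ v½ = v½
f¬ v1 = v0

f∨ : V3 → V3 → V3
f∨ v1 _  = v1
f∨ v½ v1 = v1
f∨ v½ _  = v½
f∨ v0 y  = y

f∧ : V3 → V3 → V3
f∧ v0 _  = v0
f∧ v½ v0 = v0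
f∧ v½ _  = v½
f∧ v1 y  = y

f⇒ : V3 → V3 → V3
f⇒ x y = f∨ (f¬ x) y

Valuation : Set
Valuation = Prop → V3

⟦_⟧ : For → Valuation → V3
⟦ var p ⟧ v = v p
⟦ ¬' a ⟧ v = f¬ (⟦ a ⟧ v)
⟦ a ∨' b ⟧ v = f∨ (⟦ a ⟧ v) (⟦ b ⟧ v)
⟦ a ∧' b ⟧ v = f∧ (⟦ a ⟧ v) (⟦ b ⟧ v)
⟦ a ⇒' b ⟧ v = f⇒ (⟦ a ⟧ v) (⟦ b ⟧ v)

_⊨K3_ : Pred For 0ℓ → For → Set
Γ ⊨K3 α = (v : Valuation) → (∀ γ → γ ∈ Γ → ⟦ γ ⟧ v ≡ v1) → ⟦ α ⟧ v ≡ v1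

CnK3 : Pred For 0ℓ → Pred For 0ℓ
CnK3 Γ α = Γ ⊨K3 α

record ConsStruct (a b : Level) : Set (suc (a ⊔ b)) where
  field
    X  : Set
    Cn : Pred X a → Pred X b
open ConsStruct public

Consistent : ∀ {a b} (L : ConsStruct a b) → Pred (X L) a → Set b
Consistent L Γ = ¬ (∀ x → x ∈ Cn L Γ)

ℙ : ∀ {a b} → ConsStruct a b → ConsStruct a (suc a ⊔ b)
X (ℙ L) = X L
Cn (ℙ L) Γ x = Σ (Pred (X L) _) λ Γ' → (Γ' ⊆ Γ) × Consistent L Γ' × (x ∈ Cn L Γ')

K3 : ConsStruct 0ℓ 0ℓ
X K3 = For
Cn K3 = CnK3

_≐_ : ∀ {A : Set} {a b} → Pred A a → Pred A b → Set _
P ≐ Q = (P ⊆ Q) × (Q ⊆ P)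

-- Collapsing ℙℙ to ℙ only needs one formula that no consistent set entails:
-- then every set, even the empty one, is ℙ-consistent, so ℙ may be applied
-- to Γ' itself.  In K3 the contradiction p ∧ ¬p takes no designated value,
-- so any set entailing it has no model and entails everything.
module Submission where

open import Defs
open import Relation.Unary using (Pred; _⊆_; _∈_)
open import Level using (Level; 0ℓ)
open import Data.Product using (_,_)
open import Data.Empty using (⊥-elim)
open import Relation.Nullary using (¬_)
open import Relation.Binary.PropositionalEquality using (_≡_)

module _ {a b : Level} (L : ConsStruct a b) where

  Cn-ℙℙ⊆Cn-ℙ : (Γ : Pred (X L) a) → Cn (ℙ (ℙ L)) Γ ⊆ Cn (ℙ L) Γ
  Cn-ℙℙ⊆Cn-ℙ Γ (Γ' , Γ'⊆Γ , _ , Γ'' , Γ''⊆Γ' , Γ''-cons , x∈Cn) =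
    Γ'' , (λ z → Γ'⊆Γ (Γ''⊆Γ' z)) , Γ''-cons , x∈Cn

  Cn-ℙ⊆Cn-ℙℙ : (∀ Γ → Consistent (ℙ L) Γ) → (Γ : Pred (X L) a) → Cn (ℙ L) Γ ⊆ Cn (ℙ (ℙ L)) Γ
  Cn-ℙ⊆Cn-ℙℙ all-cons Γ (Γ' , Γ'⊆Γ , Γ'-cons , x∈Cn) =
    Γ' , Γ'⊆Γ , all-cons Γ' , Γ' , (λ z → z) , Γ'-cons , x∈Cn

  Cn-ℙℙ≐Cn-ℙ : (∀ Γ → Consistent (ℙ L) Γ) → (Γ : Pred (X L) a) → Cn (ℙ (ℙ L)) Γ ≐ Cn (ℙ L) Γ
  Cn-ℙℙ≐Cn-ℙ all-cons Γ =
    (λ {x} → Cn-ℙℙ⊆Cn-ℙ Γ {x}) , (λ {x} → Cn-ℙ⊆Cn-ℙℙ all-cons Γ {x})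

  ℙ-consistent : (x : X L) → (∀ Γ → x ∈ Cn L Γ → ¬ Consistent L Γ) →
                 (Γ : Pred (X L) a) → Consistent (ℙ L) Γ
  ℙ-consistent x x-explosive Γ x∈all with x∈all x
  ... | (Γ' , _ , Γ'-cons , x∈Cn) = x-explosive Γ' x∈Cn Γ'-cons

p∧¬p : For
p∧¬p = var 0 ∧' (¬' var 0)

p∧¬p-never-designated : (v : Valuation) → ¬ (⟦ p∧¬p ⟧ v ≡ v1)
p∧¬p-never-designated v with v 0
... | v0 = λ ()
... | v½ = λ ()
... | v1 = λ ()

p∧¬p-explosive : (Γ : Pred For 0ℓ) → p∧¬p ∈ CnK3 Γ → ¬ Consistent K3 Γ
p∧¬p-explosive Γ Γ⊨p∧¬p Γ-cons =
  Γ-cons (λ α v v⊨Γ → ⊥-elim (p∧¬p-never-designated v (Γ⊨p∧¬p v v⊨Γ)))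

proposition22 : (Γ : Pred For 0ℓ) → Cn (ℙ (ℙ K3)) Γ ≐ Cn (ℙ K3) Γ
proposition22 = Cn-ℙℙ≐Cn-ℙ K3 (ℙ-consistent K3 p∧¬p p∧¬p-explosive)
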